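{- Let $H$ be a subgraph of a finite simple graph $G$, and let $\frac{\mathbf{c}_1}{b_1},\frac{\mathbf{c}_2}{b_2}\in\mathcal{F}(H)$ both be fully extensible in $\mathcal{F}(G)$. Then for every $\lambda\in\mathbb{Q}\cap[0,1]$, the fractional coloring $\lambda\frac{\mathbf{c}_1}{b_1}+(1-\lambda)\frac{\mathbf{c}_2}{b_2}$ is fully extensible in $\mathcal{F}(G)$.
   Context: A $b$-fold coloring $\mathbf{c}$ of a graph assigns to each vertex a set of $b$ colors so that adjacent vertices receive disjoint sets; $A(\mathbf{c})$ is the set of colors used. Two $b$-fold colorings are isomorphic if they differ by a bijective renaming of colors. $\mathbf{c}_1+\mathbf{c}_2$ assigns each vertex the disjoint union of its color sets, and $t\cdot\mathbf{c}$ is the sum of $t$ copies. For $\mathbf{c}_1$ $b_1$-fold and $\mathbf{c}_2$ $b_2$-fold, $\mathbf{c}_1\sim\mathbf{c}_2$ if $sb_2\cdot\mathbf{c}_1$ and $sb_1\cdot\mathbf{c}_2$ are isomorphic for some positive integer $s$. The set $\mathcal{F}(G)$ of fractional colorings of $G$ is the set of $\sim$-classes of (isomorphism classes of) multifold colorings of $G$; the class of a $b$-fold coloring $\mathbf{c}$ is written $\frac{\mathbf{c}}{b}$. For rational $\lambda=q/p\in[0,1]$, $\lambda\frac{\mathbf{c}_1}{b_1}+(1-\lambda)\frac{\mathbf{c}_2}{b_2}=\frac{qb_2\cdot\mathbf{c}_1+(p-q)b_1\cdot\mathbf{c}_2}{pb_1b_2}$. Let $g_G(\frac{\mathbf{c}}{b})=|A(\mathbf{c})|/b$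 and $\mathcal{F}_t(G)=\{f\in\mathcal{F}(G):g_G(f)\le t\}$. For a subgraph $H$ of $G$, restricting a $b$-fold coloring of $G$ to $H$ induces a map $i_G^H\colon\mathcal{F}(G)\to\mathcal{F}(H)$. A fractional coloring $f\in\mathcal{F}(H)$ is extensible in $\mathcal{F}_t(G)$ if there is $f'\in\mathcal{F}_t(G)$ with $i_G^H(f')=f$; it is fully extensible in $\mathcal{F}(G)$ if it is extensible in $\mathcal{F}_t(G)$ with $t=g_H(f)$. -}

module Defs where

open import Data.Nat using (ℕ; zero; suc; _+_; _*_; _∸_; _≤_)
open import Data.Fin using (Fin)
open import Data.Fin.Subset using (Subset; _∈_; ∣_∣; ⋃)
open import Data.Vec using ([]; _++_)
open import Data.List using (List; map; allFin)
open import Data.Product using (Σ; Σ-syntax; _×_; _,_; proj₁)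
open import Data.Empty using (⊥)
open import Relation.Binary.PropositionalEquality using (_≡_)
open import Relation.Nullary using (¬_)

record Graph : Set₁ where
  field
    n       : ℕ
    Adj     : Fin n → Fin n → Set
    symm    : ∀ {u v} → Adj u v → Adj v u
    irrefl  : ∀ {u} → ¬ Adj u u
open Graph public

-- H is a subgraph of G: an injective vertex map preserving adjacency
-- (identifies H with its image, a subgraph of G).
record Subgraph (H G : Graph) : Set where
  field
    ι      : Fin (n H) → Fin (n G)
    inj    : ∀ {u v} → ι u ≡ ι v → u ≡ v
    edges  : ∀ {u v} → Adj H u v → Adj G (ι u) (ι v)
open Subgraph public

-- Raw colour-set assignment on m vertices with palette Fin k
-- (colours not in any set are simply unused).
RawCol : ℕ → Set
RawCol m = Σ[ k ∈ ℕ ] (Fin m → Subset k)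

used : ∀ {m} (c : RawCol m) → Subset (proj₁ c)
used {m} (k , col) = ⋃ (map col (allFin m))

#A : ∀ {m} → RawCol m → ℕ
#A c = ∣ used c ∣

IsFold : (G : Graph) → ℕ → RawCol (n G) → Set
IsFold G b (k , col) =
  (∀ v → ∣ col v ∣ ≡ b) ×
  (∀ u v → Adj G u v → ∀ (x : Fin k) → x ∈ col u → x ∈ col v → ⊥)

-- c₁ + c₂ : disjoint union of colour sets (palettes placed side by side).
infixl 6 _⊕_
infixr 7 _·_
infix 4 _≅_

_⊕_ : ∀ {m} → RawCol m → RawCol m → RawCol m
(k₁ , c₁) ⊕ (k₂ , c₂) = (k₁ + k₂) , (λ v → c₁ v ++ c₂ v)

_·_ : ∀ {m} → ℕ → RawCol m → RawCol m
zero  · c = 0 , (λ _ → [])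
suc t · c = c ⊕ (t · c)

_≅_ : ∀ {m} → RawCol m → RawCol m → Set
_≅_ {m} (k₁ , c₁) (k₂ , c₂) =
  Σ[ f ∈ (Fin k₁ → Fin k₂) ] Σ[ g ∈ (Fin k₂ → Fin k₁) ]
    (∀ v x → x ∈ c₁ v → f x ∈ c₂ v) ×
    (∀ v y → y ∈ c₂ v → g y ∈ c₁ v) ×
    (∀ v x → x ∈ c₁ v → g (f x) ≡ x) ×
    (∀ v y → y ∈ c₂ v → f (g y) ≡ y)

-- Fractional colouring c/b of G (a representative of its ∼-class).
record Frac (G : Graph) : Set where
  field
    col   : RawCol (n G)
    b     : ℕ
    b≥1   : 1 ≤ b
    fold  : IsFold G b col
open Frac public

SimRaw : ∀ {m} → RawCol m → ℕ → RawCol m → ℕ → Set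
SimRaw c₁ b₁ c₂ b₂ = Σ[ s ∈ ℕ ] (1 ≤ s × ((s * b₂) · c₁ ≅ (s * b₁) · c₂))

_∼_ : ∀ {G} → Frac G → Frac G → Set
f₁ ∼ f₂ = SimRaw (col f₁) (b f₁) (col f₂) (b f₂)

restrictRaw : ∀ {H G} → Subgraph H G → RawCol (n G) → RawCol (n H)
restrictRaw S (k , c) = k , (λ v → c (ι S v))

-- g_G(f') ≤ g_H(f), i.e. |A(c')|/b' ≤ |A(c)|/b, by cross-multiplication.
-- Stated for a representative (c , b) of a class in F(H).
FullyExtensible : ∀ {H G} → Subgraph H G → RawCol (n H) → ℕ → Set
FullyExtensible {H} {G} S c b₀ =
  Σ[ f' ∈ Frac G ]
    ((#A (col f') * b₀ ≤ #A c * b f') ×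
     SimRaw (restrictRaw S (col f')) (b f') c b₀)

-- λ (c₁/b₁) + (1-λ)(c₂/b₂) for λ = q/p : (q b₂·c₁ + (p-q) b₁·c₂) / (p b₁ b₂).
combCol : ∀ {m} → ℕ → ℕ → RawCol m → ℕ → RawCol m → ℕ → RawCol m
combCol p q c₁ b₁ c₂ b₂ = ((q * b₂) · c₁) ⊕ (((p ∸ q) * b₁) · c₂)

combB : ℕ → ℕ → ℕ → ℕ
combB p b₁ b₂ = p * b₁ * b₂

-- The key notion is an *exact extension* of a colouring c/b of H: a colouring
-- d of G which is (m·b)-fold, whose restriction to H is isomorphic to m·c on
-- the nose, and which uses at most m·|A(c)| colours.  Every full extension
-- (F, s) of c/b yields one, namely (s·b)·F with m = s·e where F is e-fold;
-- conversely an exact extension is a full extension with s = 1.  Exact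
-- extensions of c₁/b₁ (factor m₁) and c₂/b₂ (factor m₂) combine: for any
-- weights w₁, w₂ the colouring (w₁m₂)·d₁ + (w₂m₁)·d₂ is an exact extension
-- of w₁·c₁ + w₂·c₂ with factor m₁m₂.  The theorem is the case w₁ = q·b₂,
-- w₂ = (p-q)·b₁, where w₁b₁ + w₂b₂ = p·b₁b₂.

module Submission where

open import Defs
open import Data.Bool using (true; false; _∨_)
open import Data.Empty using (⊥)
open import Data.Fin using (Fin; splitAt; join; cast)
open import Data.Fin.Properties using (splitAt-join; join-splitAt; +↔⊎; cast-involutive)
open import Data.Fin.Subset using (Subset; _∈_; ∣_∣; ⋃; _∪_) renaming (⊥ to ∅)
open import Data.List using (List; []; _∷_; map; allFin)
open import Data.Nat using (ℕ; zero; suc; _+_; _*_; _∸_; _≤_)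
open import Data.Nat.Properties
  using (+-assoc; *-mono-≤; *-monoʳ-≤; *-monoˡ-≤; +-mono-≤; ≤-refl; m+[n∸m]≡n; module ≤-Reasoning)
open import Data.Nat.Tactic.RingSolver using (solve-∀)
open import Data.Product using (_,_)
open import Data.Sum using (_⊎_; inj₁; inj₂; [_,_]′; swap) renaming (map to ⊎-map)
open import Data.Sum.Properties using (swap-↔)
open import Data.Vec using (_++_; lookup)
import Data.Vec as Vec
open import Data.Vec.Properties using (lookup-splitAt; lookup-cast; ++-assoc-eqFree; zipWith-++; []=⇒lookup; lookup⇒[]=)
open import Function.Base using (_∘_)
open import Function.Bundles using (_↔_; mk↔ₛ′; Inverse)
open import Function.Properties.Inverse using (↔-trans; ↔-sym)
open import Relation.Binary.PropositionalEquality

InBlock : ∀ {a b} → Subset a → Subset b → Fin a ⊎ Fin b → Set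
InBlock p q = [ _∈ p , _∈ q ]′

∈++⇒InBlock : ∀ {a b} (p : Subset a) (q : Subset b) x →
              x ∈ p ++ q → InBlock p q (splitAt a x)
∈++⇒InBlock {a} p q x x∈ =
  fromLookup (splitAt a x) (trans (sym (lookup-splitAt a p q x)) ([]=⇒lookup x∈))
  where
  fromLookup : ∀ s → [ lookup p , lookup q ]′ s ≡ true → InBlock p q s
  fromLookup (inj₁ y) = lookup⇒[]= y p
  fromLookup (inj₂ y) = lookup⇒[]= y q

InBlock⇒∈++ : ∀ {a b} (p : Subset a) (q : Subset b) s →
              InBlock p q s → join a b s ∈ p ++ q
InBlock⇒∈++ {a} {b} p q s s∈ = lookup⇒[]= (join a b s) (p ++ q) (begin
  lookup (p ++ q) (join a b s)                        ≡⟨ lookup-splitAt a p q (join a b s) ⟩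
  [ lookup p , lookup q ]′ (splitAt a (join a b s))   ≡⟨ cong [ lookup p , lookup q ]′ (splitAt-join a b s) ⟩
  [ lookup p , lookup q ]′ s                          ≡⟨ toLookup s s∈ ⟩
  true                                                ∎)
  where
  open ≡-Reasoning
  toLookup : ∀ s → InBlock p q s → [ lookup p , lookup q ]′ s ≡ true
  toLookup (inj₁ y) = []=⇒lookup
  toLookup (inj₂ y) = []=⇒lookup

≅-refl : ∀ {m} (X : RawCol m) → X ≅ X
≅-refl X = (λ x → x) , (λ x → x) , (λ _ _ x∈ → x∈) , (λ _ _ y∈ → y∈) , (λ _ _ _ → refl) , (λ _ _ _ → refl)

≅-reflexive : ∀ {m} {X Y : RawCol m} → X ≡ Y → X ≅ Y
≅-reflexive {X = X} refl = ≅-refl X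

≅-sym : ∀ {m} {X Y : RawCol m} → X ≅ Y → Y ≅ X
≅-sym {X = _ , _} {_ , _} (f , g , f∈ , g∈ , gf , fg) = g , f , g∈ , f∈ , fg , gf

≅-trans : ∀ {m} {X Y Z : RawCol m} → X ≅ Y → Y ≅ Z → X ≅ Z
≅-trans {X = _ , _} {_ , _} {_ , _} (f , g , f∈ , g∈ , gf , fg) (f' , g' , f'∈ , g'∈ , g'f' , f'g') =
  (λ x → f' (f x)) , (λ z → g (g' z)) ,
  (λ v x x∈ → f'∈ v (f x) (f∈ v x x∈)) , (λ v z z∈ → g∈ v (g' z) (g'∈ v z z∈)) ,
  (λ v x x∈ → trans (cong g (g'f' v (f x) (f∈ v x x∈))) (gf v x x∈)) ,
  (λ v z z∈ → trans (cong f' (fg v (g' z) (g'∈ v z z∈))) (f'g' v z z∈))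

relabel : ∀ {m k₁ k₂} {c₁ : Fin m → Subset k₁} {c₂ : Fin m → Subset k₂} (φ : Fin k₁ ↔ Fin k₂) →
          (∀ v x → lookup (c₂ v) (Inverse.to φ x) ≡ lookup (c₁ v) x) → (k₁ , c₁) ≅ (k₂ , c₂)
relabel {c₁ = c₁} {c₂} φ preserves =
  to , from , forward , backward , (λ _ x _ → strictlyInverseʳ x) , (λ _ y _ → strictlyInverseˡ y)
  where
  open Inverse φ
  forward : ∀ v x → x ∈ c₁ v → to x ∈ c₂ v
  forward v x x∈ = lookup⇒[]= (to x) (c₂ v) (trans (preserves v x) ([]=⇒lookup x∈))
  backward : ∀ v y → y ∈ c₂ v → from y ∈ c₁ v
  backward v y y∈ = lookup⇒[]= (from y) (c₁ v)
    (trans (sym (preserves v (from y))) (trans (cong (lookup (c₂ v)) (strictlyInverseˡ y)) ([]=⇒lookup y∈)))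

⊕-assoc : ∀ {m} (X Y Z : RawCol m) → ((X ⊕ Y) ⊕ Z) ≅ (X ⊕ (Y ⊕ Z))
⊕-assoc (a , p) (b , q) (c , r) = relabel reassociate preserves
  where
  a+b+c≡ : (a + b) + c ≡ a + (b + c)
  a+b+c≡ = +-assoc a b c
  reassociate : Fin ((a + b) + c) ↔ Fin (a + (b + c))
  reassociate = mk↔ₛ′ (cast a+b+c≡) (cast (sym a+b+c≡))
                      (cast-involutive a+b+c≡ (sym a+b+c≡)) (cast-involutive (sym a+b+c≡) a+b+c≡)
  preserves : ∀ v x → lookup (p v ++ (q v ++ r v)) (cast a+b+c≡ x) ≡ lookup ((p v ++ q v) ++ r v) x
  preserves v x = trans (cong (λ w → lookup w (cast a+b+c≡ x)) (sym (++-assoc-eqFree (p v) (q v) (r v))))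
                        (lookup-cast a+b+c≡ ((p v ++ q v) ++ r v) x)

⊕-comm : ∀ {m} (X Y : RawCol m) → (X ⊕ Y) ≅ (Y ⊕ X)
⊕-comm (a , p) (b , q) = relabel (↔-trans (+↔⊎ {a} {b}) (↔-trans swap-↔ (↔-sym (+↔⊎ {b} {a})))) preserves
  where
  swap-[,] : ∀ {C : Set} (f : Fin a → C) (g : Fin b → C) s → [ g , f ]′ (swap s) ≡ [ f , g ]′ s
  swap-[,] f g (inj₁ x) = refl
  swap-[,] f g (inj₂ y) = refl
  preserves : ∀ v x → lookup (q v ++ p v) (join b a (swap (splitAt a x))) ≡ lookup (p v ++ q v) x
  preserves v x = begin
    lookup (q v ++ p v) (join b a (swap (splitAt a x)))
      ≡⟨ lookup-splitAt b (q v) (p v) _ ⟩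
    [ lookup (q v) , lookup (p v) ]′ (splitAt b (join b a (swap (splitAt a x))))
      ≡⟨ cong [ lookup (q v) , lookup (p v) ]′ (splitAt-join b a (swap (splitAt a x))) ⟩
    [ lookup (q v) , lookup (p v) ]′ (swap (splitAt a x))
      ≡⟨ swap-[,] (lookup (p v)) (lookup (q v)) (splitAt a x) ⟩
    [ lookup (p v) , lookup (q v) ]′ (splitAt a x)
      ≡⟨ sym (lookup-splitAt a (p v) (q v) x) ⟩
    lookup (p v ++ q v) x
      ∎
    where open ≡-Reasoning

blockMap : ∀ {a b a' b'} → (Fin a → Fin a') → (Fin b → Fin b') → Fin (a + b) → Fin (a' + b')
blockMap {a} {b} {a'} {b'} h₁ h₂ z = join a' b' (⊎-map h₁ h₂ (splitAt a z))

blockMap-∈ : ∀ {a b a' b'} (p : Subset a) (q : Subset b) (p' : Subset a') (q' : Subset b')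
             (h₁ : Fin a → Fin a') (h₂ : Fin b → Fin b') →
             (∀ x → x ∈ p → h₁ x ∈ p') → (∀ y → y ∈ q → h₂ y ∈ q') →
             ∀ z → z ∈ p ++ q → blockMap h₁ h₂ z ∈ p' ++ q'
blockMap-∈ {a} p q p' q' h₁ h₂ h₁∈ h₂∈ z z∈ =
  InBlock⇒∈++ p' q' (⊎-map h₁ h₂ (splitAt a z)) (mapInBlock (splitAt a z) (∈++⇒InBlock p q z z∈))
  where
  mapInBlock : ∀ s → InBlock p q s → InBlock p' q' (⊎-map h₁ h₂ s)
  mapInBlock (inj₁ x) = h₁∈ x
  mapInBlock (inj₂ y) = h₂∈ y

blockMap-inverse : ∀ {a b a' b'} (p : Subset a) (q : Subset b)
                   (f₁ : Fin a → Fin a') (g₁ : Fin a' → Fin a) (f₂ : Fin b → Fin b') (g₂ : Fin b' → Fin b) →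
                   (∀ x → x ∈ p → g₁ (f₁ x) ≡ x) → (∀ y → y ∈ q → g₂ (f₂ y) ≡ y) →
                   ∀ z → z ∈ p ++ q → blockMap g₁ g₂ (blockMap f₁ f₂ z) ≡ z
blockMap-inverse {a} {b} {a'} {b'} p q f₁ g₁ f₂ g₂ gf₁ gf₂ z z∈ = begin
  join a b (⊎-map g₁ g₂ (splitAt a' (join a' b' (⊎-map f₁ f₂ (splitAt a z)))))
    ≡⟨ cong (join a b ∘ ⊎-map g₁ g₂) (splitAt-join a' b' (⊎-map f₁ f₂ (splitAt a z))) ⟩
  join a b (⊎-map g₁ g₂ (⊎-map f₁ f₂ (splitAt a z)))
    ≡⟨ cong (join a b) (roundTrip (splitAt a z) (∈++⇒InBlock p q z z∈)) ⟩
  join a b (splitAt a z)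
    ≡⟨ join-splitAt a b z ⟩
  z ∎
  where
  open ≡-Reasoning
  roundTrip : ∀ s → InBlock p q s → ⊎-map g₁ g₂ (⊎-map f₁ f₂ s) ≡ s
  roundTrip (inj₁ x) x∈ = cong inj₁ (gf₁ x x∈)
  roundTrip (inj₂ y) y∈ = cong inj₂ (gf₂ y y∈)

⊕-cong : ∀ {m} {X X' Y Y' : RawCol m} → X ≅ X' → Y ≅ Y' → (X ⊕ Y) ≅ (X' ⊕ Y')
⊕-cong {X = _ , c₁} {_ , c₁'} {_ , c₂} {_ , c₂'}
       (f₁ , g₁ , f₁∈ , g₁∈ , g₁f₁ , f₁g₁) (f₂ , g₂ , f₂∈ , g₂∈ , g₂f₂ , f₂g₂) =
  blockMap f₁ f₂ , blockMap g₁ g₂ ,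
  (λ v → blockMap-∈ (c₁ v) (c₂ v) (c₁' v) (c₂' v) f₁ f₂ (f₁∈ v) (f₂∈ v)) ,
  (λ v → blockMap-∈ (c₁' v) (c₂' v) (c₁ v) (c₂ v) g₁ g₂ (g₁∈ v) (g₂∈ v)) ,
  (λ v → blockMap-inverse (c₁ v) (c₂ v) f₁ g₁ f₂ g₂ (g₁f₁ v) (g₂f₂ v)) ,
  (λ v → blockMap-inverse (c₁' v) (c₂' v) g₁ f₁ g₂ f₂ (f₁g₁ v) (f₂g₂ v))

⊕-interchange : ∀ {m} (X Y Z W : RawCol m) → ((X ⊕ Y) ⊕ (Z ⊕ W)) ≅ ((X ⊕ Z) ⊕ (Y ⊕ W))
⊕-interchange X Y Z W =
  ≅-trans (⊕-assoc X Y (Z ⊕ W))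
  (≅-trans (⊕-cong (≅-refl X) (≅-sym (⊕-assoc Y Z W)))
  (≅-trans (⊕-cong (≅-refl X) (⊕-cong (⊕-comm Y Z) (≅-refl W)))
  (≅-trans (⊕-cong (≅-refl X) (⊕-assoc Z Y W))
  (≅-sym (⊕-assoc X Z (Y ⊕ W))))))

·-cong : ∀ {m} t {X Y : RawCol m} → X ≅ Y → (t · X) ≅ (t · Y)
·-cong zero    X≅Y = ≅-refl _
·-cong (suc t) X≅Y = ⊕-cong X≅Y (·-cong t X≅Y)

·-+ : ∀ {m} a b (X : RawCol m) → ((a + b) · X) ≅ ((a · X) ⊕ (b · X))
·-+ zero    b X = ≅-refl _
·-+ (suc a) b X = ≅-trans (⊕-cong (≅-refl X) (·-+ a b X)) (≅-sym (⊕-assoc X (a · X) (b · X)))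

·-* : ∀ {m} a b (X : RawCol m) → ((a * b) · X) ≅ (a · (b · X))
·-* zero    b X = ≅-refl _
·-* (suc a) b X = ≅-trans (·-+ b (a * b) X) (⊕-cong (≅-refl (b · X)) (·-* a b X))

·-⊕ : ∀ {m} t (X Y : RawCol m) → (t · (X ⊕ Y)) ≅ ((t · X) ⊕ (t · Y))
·-⊕ zero    X Y = ≅-refl _
·-⊕ (suc t) X Y =
  ≅-trans (⊕-cong (≅-refl (X ⊕ Y)) (·-⊕ t X Y)) (⊕-interchange X Y (t · X) (t · Y))

·-regroup : ∀ {m} a b a' b' (X : RawCol m) → a * b ≡ a' * b' → (a · (b · X)) ≅ (a' · (b' · X))
·-regroup a b a' b' X ab≡a'b' =
  ≅-trans (≅-sym (·-* a b X)) (≅-trans (≅-reflexive (cong (_· X) ab≡a'b')) (·-* a' b' X))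

∣++∣ : ∀ {a b} (p : Subset a) (q : Subset b) → ∣ p ++ q ∣ ≡ ∣ p ∣ + ∣ q ∣
∣++∣ Vec.[]          q = refl
∣++∣ (true Vec.∷ p)  q = cong suc (∣++∣ p q)
∣++∣ (false Vec.∷ p) q = ∣++∣ p q

fold-⊕ : ∀ G {b₁ b₂} (X Y : RawCol (n G)) → IsFold G b₁ X → IsFold G b₂ Y → IsFold G (b₁ + b₂) (X ⊕ Y)
fold-⊕ G (k₁ , c) (_ , d) (size₁ , disjoint₁) (size₂ , disjoint₂) =
  (λ v → trans (∣++∣ (c v) (d v)) (cong₂ _+_ (size₁ v) (size₂ v))) , disjoint
  where
  disjoint : ∀ u v → Adj G u v → ∀ x → x ∈ c u ++ d u → x ∈ c v ++ d v → ⊥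
  disjoint u v uv x xu xv =
    blocksDisjoint (splitAt k₁ x) (∈++⇒InBlock (c u) (d u) x xu) (∈++⇒InBlock (c v) (d v) x xv)
    where
    blocksDisjoint : ∀ s → InBlock (c u) (d u) s → InBlock (c v) (d v) s → ⊥
    blocksDisjoint (inj₁ y) = disjoint₁ u v uv y
    blocksDisjoint (inj₂ y) = disjoint₂ u v uv y

fold-· : ∀ G {b} t (X : RawCol (n G)) → IsFold G b X → IsFold G (t * b) (t · X)
fold-· G zero    X fold-X = (λ _ → refl) , (λ _ _ _ _ ())
fold-· G (suc t) X fold-X = fold-⊕ G X (t · X) fold-X (fold-· G t X fold-X)

⋃-++ : ∀ {m a b} (c : Fin m → Subset a) (d : Fin m → Subset b) (vs : List (Fin m)) →
       ⋃ (map (λ v → c v ++ d v) vs) ≡ ⋃ (map c vs) ++ ⋃ (map d vs)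
⋃-++ {a = a} {b} c d []       = emptyBlocks a
  where
  emptyBlocks : ∀ a → (∅ {a + b}) ≡ ∅ {a} ++ ∅ {b}
  emptyBlocks zero    = refl
  emptyBlocks (suc a) = cong (false Vec.∷_) (emptyBlocks a)
⋃-++ c d (v ∷ vs) =
  trans (cong ((c v ++ d v) ∪_) (⋃-++ c d vs))
        (zipWith-++ _∨_ (c v) (d v) (⋃ (map c vs)) (⋃ (map d vs)))

#A-⊕ : ∀ {m} (X Y : RawCol m) → #A (X ⊕ Y) ≡ #A X + #A Y
#A-⊕ {m} (_ , c) (_ , d) =
  trans (cong ∣_∣ (⋃-++ c d (allFin m))) (∣++∣ (⋃ (map c (allFin m))) (⋃ (map d (allFin m))))

#A-· : ∀ {m} t (X : RawCol m) → #A (t · X) ≡ t * #A X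
#A-· zero    X = emptyPalette (used (zero · X))
  where
  emptyPalette : (p : Subset 0) → ∣ p ∣ ≡ 0
  emptyPalette Vec.[] = refl
#A-· (suc t) X = trans (#A-⊕ X (t · X)) (cong (#A X +_) (#A-· t X))

#A-weighted : ∀ {m} u v (X Y : RawCol m) → #A ((u · X) ⊕ (v · Y)) ≡ u * #A X + v * #A Y
#A-weighted u v X Y = trans (#A-⊕ (u · X) (v · Y)) (cong₂ _+_ (#A-· u X) (#A-· v Y))

restrict-⊕ : ∀ {H G} (S : Subgraph H G) (X Y : RawCol (n G)) →
             restrictRaw S (X ⊕ Y) ≡ restrictRaw S X ⊕ restrictRaw S Y
restrict-⊕ S (_ , _) (_ , _) = refl

restrict-· : ∀ {H G} (S : Subgraph H G) t (X : RawCol (n G)) →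
             restrictRaw S (t · X) ≡ t · restrictRaw S X
restrict-· S zero    X = refl
restrict-· S (suc t) X = trans (restrict-⊕ S X (t · X)) (cong (restrictRaw S X ⊕_) (restrict-· S t X))

record ExactExtension {H G : Graph} (S : Subgraph H G) (c : RawCol (n H)) (b₀ : ℕ) : Set where
  field
    factor   : ℕ
    factor≥1 : 1 ≤ factor
    ext      : RawCol (n G)
    ext-fold : IsFold G (factor * b₀) ext
    ext-restrict : restrictRaw S ext ≅ (factor · c)
    ext-count    : #A ext ≤ factor * #A c

fullyExtensible⇒exact : ∀ {H G} (S : Subgraph H G) (c : RawCol (n H)) (b₀ : ℕ) →
                        FullyExtensible S c b₀ → ExactExtension S c b₀
fullyExtensible⇒exact {G = G} S c b₀ (F , cost , s , s≥1 , restriction≅) = record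
  { factor       = s * e
  ; factor≥1     = *-mono-≤ s≥1 (b≥1 F)
  ; ext          = (s * b₀) · d
  ; ext-fold     = subst (λ w → IsFold G w ((s * b₀) · d)) (fold-size s b₀ e) (fold-· G (s * b₀) d (fold F))
  ; ext-restrict = ≅-trans (≅-reflexive (restrict-· S (s * b₀) d)) restriction≅
  ; ext-count    = count
  }
  where
  d : RawCol (n G)
  d = col F
  e : ℕ
  e = Frac.b F
  fold-size : ∀ s b e → s * b * e ≡ s * e * b
  fold-size = solve-∀
  *-assoc-swap : ∀ s x y → s * x * y ≡ s * (y * x)
  *-assoc-swap = solve-∀
  open ≤-Reasoning
  count : #A ((s * b₀) · d) ≤ s * e * #A c
  count = begin
    #A ((s * b₀) · d)  ≡⟨ #A-· (s * b₀) d ⟩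
    s * b₀ * #A d      ≡⟨ *-assoc-swap s b₀ (#A d) ⟩
    s * (#A d * b₀)    ≤⟨ *-monoʳ-≤ s cost ⟩
    s * (#A c * e)     ≡⟨ sym (*-assoc-swap s e (#A c)) ⟩
    s * e * #A c       ∎

exact⇒fullyExtensible : ∀ {H G} (S : Subgraph H G) (c : RawCol (n H)) (b₀ : ℕ) →
                        1 ≤ b₀ → ExactExtension S c b₀ → FullyExtensible S c b₀
exact⇒fullyExtensible {G = G} S c b₀ b₀≥1 E =
  F , cost , 1 , ≤-refl ,
  ≅-trans (·-cong (1 * b₀) ext-restrict)
    (≅-trans (≅-sym (·-* (1 * b₀) factor c)) (≅-reflexive (cong (_· c) (regroup b₀ factor))))
  where
  open ExactExtension E
  F : Frac G
  F = record { col = ext ; b = factor * b₀ ; b≥1 = *-mono-≤ factor≥1 b₀≥1 ; fold = ext-fold }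
  rearrange : ∀ m x b → m * x * b ≡ x * (m * b)
  rearrange = solve-∀
  regroup : ∀ b m → 1 * b * m ≡ 1 * (m * b)
  regroup = solve-∀
  open ≤-Reasoning
  cost : #A ext * b₀ ≤ #A c * (factor * b₀)
  cost = begin
    #A ext * b₀           ≤⟨ *-monoˡ-≤ b₀ ext-count ⟩
    factor * #A c * b₀    ≡⟨ rearrange factor (#A c) b₀ ⟩
    #A c * (factor * b₀)  ∎

combineExact : ∀ {H G} {S : Subgraph H G} {c₁ c₂ : RawCol (n H)} {b₁ b₂ : ℕ} →
               ExactExtension S c₁ b₁ → ExactExtension S c₂ b₂ → (w₁ w₂ : ℕ) →
               ExactExtension S ((w₁ · c₁) ⊕ (w₂ · c₂)) (w₁ * b₁ + w₂ * b₂)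
combineExact {G = G} {S} {c₁} {c₂} {b₁} {b₂} E₁ E₂ w₁ w₂ = record
  { factor       = m₁ * m₂
  ; factor≥1     = *-mono-≤ m₁≥1 m₂≥1
  ; ext          = d
  ; ext-fold     = subst (λ w → IsFold G w d) (fold-size w₁ w₂ m₁ m₂ b₁ b₂)
                     (fold-⊕ G ((w₁ * m₂) · d₁) ((w₂ * m₁) · d₂)
                       (fold-· G (w₁ * m₂) d₁ fold₁) (fold-· G (w₂ * m₁) d₂ fold₂))
  ; ext-restrict = restriction
  ; ext-count    = count
  }
  where
  open ExactExtension E₁ renaming (factor to m₁; factor≥1 to m₁≥1; ext to d₁; ext-fold to fold₁;
                                   ext-restrict to restrict₁; ext-count to count₁)
  open ExactExtension E₂ renaming (factor to m₂; factor≥1 to m₂≥1; ext to d₂; ext-fold to fold₂;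
                                   ext-restrict to restrict₂; ext-count to count₂)
  d : RawCol (n G)
  d = ((w₁ * m₂) · d₁) ⊕ ((w₂ * m₁) · d₂)
  fold-size : ∀ w₁ w₂ m₁ m₂ b₁ b₂ →
              w₁ * m₂ * (m₁ * b₁) + w₂ * m₁ * (m₂ * b₂) ≡ m₁ * m₂ * (w₁ * b₁ + w₂ * b₂)
  fold-size = solve-∀
  regroup₁ : ∀ w x y → w * x * y ≡ y * x * w
  regroup₁ = solve-∀
  regroup₂ : ∀ w x y → w * x * y ≡ x * y * w
  regroup₂ = solve-∀
  collect : ∀ w₁ w₂ m₁ m₂ x₁ x₂ →
            w₁ * m₂ * (m₁ * x₁) + w₂ * m₁ * (m₂ * x₂) ≡ m₁ * m₂ * (w₁ * x₁ + w₂ * x₂)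
  collect = solve-∀
  restriction : restrictRaw S d ≅ ((m₁ * m₂) · ((w₁ · c₁) ⊕ (w₂ · c₂)))
  restriction =
    ≅-trans (≅-reflexive (cong₂ _⊕_ (restrict-· S (w₁ * m₂) d₁) (restrict-· S (w₂ * m₁) d₂)))
    (≅-trans (⊕-cong (·-cong (w₁ * m₂) restrict₁) (·-cong (w₂ * m₁) restrict₂))
    (≅-trans (⊕-cong (·-regroup (w₁ * m₂) m₁ (m₁ * m₂) w₁ c₁ (regroup₁ w₁ m₂ m₁))
                     (·-regroup (w₂ * m₁) m₂ (m₁ * m₂) w₂ c₂ (regroup₂ w₂ m₁ m₂)))
             (≅-sym (·-⊕ (m₁ * m₂) (w₁ · c₁) (w₂ · c₂)))))
  open ≤-Reasoning
  count : #A d ≤ m₁ * m₂ * #A ((w₁ · c₁) ⊕ (w₂ · c₂))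
  count = begin
    #A d
      ≡⟨ #A-weighted (w₁ * m₂) (w₂ * m₁) d₁ d₂ ⟩
    w₁ * m₂ * #A d₁ + w₂ * m₁ * #A d₂
      ≤⟨ +-mono-≤ (*-monoʳ-≤ (w₁ * m₂) count₁) (*-monoʳ-≤ (w₂ * m₁) count₂) ⟩
    w₁ * m₂ * (m₁ * #A c₁) + w₂ * m₁ * (m₂ * #A c₂)
      ≡⟨ collect w₁ w₂ m₁ m₂ (#A c₁) (#A c₂) ⟩
    m₁ * m₂ * (w₁ * #A c₁ + w₂ * #A c₂)
      ≡⟨ cong (m₁ * m₂ *_) (sym (#A-weighted w₁ w₂ c₁ c₂)) ⟩
    m₁ * m₂ * #A ((w₁ · c₁) ⊕ (w₂ · c₂))
      ∎

convexWeights : ∀ p q b₁ b₂ → q ≤ p → q * b₂ * b₁ + (p ∸ q) * b₁ * b₂ ≡ combB p b₁ b₂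
convexWeights p q b₁ b₂ q≤p = begin
  q * b₂ * b₁ + (p ∸ q) * b₁ * b₂  ≡⟨ factor-out q (p ∸ q) b₁ b₂ ⟩
  (q + (p ∸ q)) * b₁ * b₂          ≡⟨ cong (λ x → x * b₁ * b₂) (m+[n∸m]≡n q≤p) ⟩
  p * b₁ * b₂                      ∎
  where
  open ≡-Reasoning
  factor-out : ∀ q r b₁ b₂ → q * b₂ * b₁ + r * b₁ * b₂ ≡ (q + r) * b₁ * b₂
  factor-out = solve-∀

lemma3 : (G H : Graph) (S : Subgraph H G) (f₁ f₂ : Frac H) →
         FullyExtensible S (Frac.col f₁) (Frac.b f₁) →
         FullyExtensible S (Frac.col f₂) (Frac.b f₂) →
         (p q : ℕ) → 1 ≤ p → q ≤ p →
         FullyExtensible S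
           (combCol p q (Frac.col f₁) (Frac.b f₁) (Frac.col f₂) (Frac.b f₂))
           (combB p (Frac.b f₁) (Frac.b f₂))
lemma3 G H S f₁ f₂ full₁ full₂ p q p≥1 q≤p =
  exact⇒fullyExtensible S combination (combB p b₁ b₂)
    (*-mono-≤ (*-mono-≤ p≥1 (b≥1 f₁)) (b≥1 f₂))
    (subst (ExactExtension S combination) (convexWeights p q b₁ b₂ q≤p)
      (combineExact (fullyExtensible⇒exact S (col f₁) b₁ full₁)
                    (fullyExtensible⇒exact S (col f₂) b₂ full₂)
                    (q * b₂) ((p ∸ q) * b₁)))
  where
  b₁ b₂ : ℕ
  b₁ = Frac.b f₁
  b₂ = Frac.b f₂
  combination : RawCol (n H)
  combination = combCol p q (col f₁) b₁ (col f₂) b₂
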